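{- For $d\ge 0$, the number of combinators of degree $d$ that are minimal elements of the poset $\mathcal{P}$ of the Mockingbird CLS is $\mathbf{a}(d)$, where $\mathbf{a}(0)=\mathbf{a}(1)=1$ and, for $d\ge 2$, $\mathbf{a}(d) = \mathbf{b}(d-1) - \mathbb{1}_{d\text{ odd}}\,\mathbf{a}((d-1)/2)$ with $\mathbf{b}(n) = \sum_{i=0}^{n}\mathbf{a}(i)\,\mathbf{a}(n-i)$. Equivalently, $F_{\min}(\mathsf{z}) = \sum_{d}\mathbf{a}(d)\mathsf{z}^d$ satisfies $F_{\min} = 1+\mathsf{z}+\mathsf{z}F_{\min}^2 - \mathsf{z}\,F_{\min}(\mathsf{z}^2)$.
   Context: Terms over $\{{\rm M}\}$ are the smallest set containing the variables $\mathsf{x}_1,\mathsf{x}_2,\dots$, the symbol ${\rm M}$, and $(\mathfrak{t}_1\mathfrak{t}_2)$ for terms $\mathfrak{t}_1,\mathfrak{t}_2$; a combinator is a term with no variables, and its degree is its number of internal (application) nodes. The rewrite relation $\Rightarrow$ is the smallest relation with ${\rm M}\,\mathfrak{s}\Rightarrow\mathfrak{s}\,\mathfrak{s}$ for every term $\mathfrak{s}$, closed under $\mathfrak{t}_1\Rightarrow\mathfrak{t}_1'$ implies $\mathfrak{t}_1\mathfrak{t}_2\Rightarrow\mathfrak{t}_1'\mathfrak{t}_2$ and $\mathfrak{t}_2\mathfrak{t}_1\Rightarrow\mathfrak{t}_2\mathfrak{t}_1'$; its reflexive-transitive closure $\preccurlyeq$ is a partial order, and $\mathcal{P}$ is the poset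 of all terms under $\preccurlyeq$. $\mathbb{1}_P$ equals $1$ if $P$ holds and $0$ otherwise. -}

module Defs where

open import Data.Nat using (ℕ; zero; suc; _+_; _*_; _∸_)
open import Data.List using (List; map; upTo)
open import Data.Nat.ListAction using (sum)
open import Relation.Binary.Construct.Closure.ReflexiveTransitive using (Star)
open import Relation.Binary.PropositionalEquality using (_≡_)

data Term : Set where
  var : ℕ → Term
  M   : Term
  _·_ : Term → Term → Term

infixl 9 _·_

data Combinator : Term → Set where
  M-comb : Combinator M
  ·-comb : ∀ {t₁ t₂} → Combinator t₁ → Combinator t₂ → Combinator (t₁ · t₂)

degree : Term → ℕ
degree (var _) = 0
degree M = 0
degree (t₁ · t₂) = suc (degree t₁ + degree t₂)

data _⇒_ : Term → Term → Set where
  M-step : ∀ s → (M · s) ⇒ (s · s)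
  left   : ∀ {t₁ t₁′} t₂ → t₁ ⇒ t₁′ → (t₁ · t₂) ⇒ (t₁′ · t₂)
  right  : ∀ {t₁ t₁′} t₂ → t₁ ⇒ t₁′ → (t₂ · t₁) ⇒ (t₂ · t₁′)

_≼_ : Term → Term → Set
_≼_ = Star _⇒_

Minimal : Term → Set
Minimal t = ∀ s → s ≼ t → s ≡ t

b : (ℕ → ℕ) → ℕ → ℕ
b a n = sum (map (λ i → a i * a (n ∸ i)) (upTo (suc n)))

-- A term is minimal iff it is square-free: its only subterm of the form s s is M M.  Indeed a
-- step M s ⇒ s s creates the square s s, which is M M only for the loop M M ⇒ M M; conversely
-- a square s s with s ≠ M has the predecessor M s.  So a combinator x y of degree d + 1 ≥ 2 is
-- minimal iff x and y are minimal and x ≠ y.  Sorting these by i = degree x gives all pairs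
-- from degrees i and d − i, that is b(d) of them, less the squares x x with degree x = d / 2,
-- of which there are a(d / 2) when d is even and none when d is odd.

module Submission where

open import Defs
open import Data.Nat using (ℕ; zero; suc; _+_; _*_; _∸_; _/_; _%_; _≥_; _≤_; _<_; z≤n; s≤s; _≟_; s≤s⁻¹)
open import Data.Nat.Properties
open import Data.Nat.DivMod using ([m+kn]%n≡m%n; m*n/n≡m; m*n%n≡0)
open import Data.List using (List; []; _∷_; _++_; [_]; map; length; concatMap; cartesianProductWith; upTo)
open import Data.List.Properties using (length-++; length-map)
open import Data.Nat.ListAction using (sum)
open import Data.List.Membership.Propositional using (_∈_; find; lose)
open import Data.List.Membership.Propositional.Properties
  using (∈-map⁺; ∈-map⁻; ∈-++⁺ˡ; ∈-++⁺ʳ; ∈-++⁻; ∈-concatMap⁺; ∈-concatMap⁻; ∈-cartesianProductWith⁺; ∈-cartesianProductWith⁻; ∈-upTo⁺; ∈-upTo⁻)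
open import Data.List.Relation.Unary.Unique.Propositional using (Unique)
import Data.List.Relation.Unary.Unique.Propositional.Properties as Unique
open import Data.List.Relation.Unary.Any using (here; there)
open import Data.List.Relation.Unary.All as All using (All; []; _∷_)
open import Data.List.Relation.Unary.AllPairs using ([]; _∷_)
open import Data.Product using (Σ; _×_; _,_; proj₁; proj₂; ∃₂; map₂)
open import Data.Sum using (inj₁; inj₂)
open import Data.Empty using (⊥-elim)
open import Function using (_∘_)
open import Function.Bundles using (_⇔_; mk⇔)
open import Relation.Nullary using (¬_; yes; no)
open import Relation.Binary.PropositionalEquality hiding ([_])
open import Relation.Binary.Construct.Closure.ReflexiveTransitive using (ε; _◅_; gmap)
import Data.Nat.Tactic.RingSolver as RingSolver
open import Algebra.Properties.CommutativeSemigroup +-commutativeSemigroup using (interchange)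

private variable
  A B C : Set

length-cartesianProductWith : (f : A → B → C) → ∀ xs ys →
  length (cartesianProductWith f xs ys) ≡ length xs * length ys
length-cartesianProductWith f [] ys = refl
length-cartesianProductWith f (x ∷ xs) ys =
  trans (length-++ (map (f x) ys))
        (cong₂ _+_ (length-map (f x) ys) (length-cartesianProductWith f xs ys))

length-concatMap : (f : A → List B) → ∀ xs → length (concatMap f xs) ≡ sum (map (length ∘ f) xs)
length-concatMap f [] = refl
length-concatMap f (x ∷ xs) =
  trans (length-++ (f x)) (cong (length (f x) +_) (length-concatMap f xs))

offDiagonalWith : (A → A → B) → List A → List B
offDiagonalWith f [] = []
offDiagonalWith f (x ∷ xs) = map (f x) xs ++ (map (λ y → f y x) xs ++ offDiagonalWith f xs)

module _ (f : A → A → B) where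

  length-offDiagonalWith : ∀ xs → length (offDiagonalWith f xs) + length xs ≡ length xs * length xs
  length-offDiagonalWith [] = refl
  length-offDiagonalWith (x ∷ xs) = begin
    length (offDiagonalWith f (x ∷ xs)) + suc n  ≡⟨ cong (_+ suc n) length-blocks ⟩
    n + (n + D) + suc n                           ≡⟨ regroup n D ⟩
    (D + n) + suc (n + n)                         ≡⟨ cong (_+ suc (n + n)) (length-offDiagonalWith xs) ⟩
    n * n + suc (n + n)                           ≡⟨ square-suc n ⟩
    suc n * suc n                                 ∎
    where
    open ≡-Reasoning
    n = length xs
    D = length (offDiagonalWith f xs)
    length-blocks : length (offDiagonalWith f (x ∷ xs)) ≡ n + (n + D)
    length-blocks = trans (length-++ (map (f x) xs)) (cong₂ _+_ (length-map (f x) xs)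
      (trans (length-++ (map (λ y → f y x) xs)) (cong (_+ D) (length-map (λ y → f y x) xs))))
    regroup : ∀ n D → n + (n + D) + suc n ≡ (D + n) + suc (n + n)
    regroup = RingSolver.solve-∀
    square-suc : ∀ n → n * n + suc (n + n) ≡ suc n * suc n
    square-suc = RingSolver.solve-∀

  ∈-offDiagonalWith⁺ : ∀ {xs x y} → x ∈ xs → y ∈ xs → x ≢ y → f x y ∈ offDiagonalWith f xs
  ∈-offDiagonalWith⁺ (here refl) (here refl) x≢y = ⊥-elim (x≢y refl)
  ∈-offDiagonalWith⁺ (here refl) (there y∈xs) _ = ∈-++⁺ˡ (∈-map⁺ (f _) y∈xs)
  ∈-offDiagonalWith⁺ {x ∷ xs} (there x∈xs) (here refl) _ =
    ∈-++⁺ʳ (map (f x) xs) (∈-++⁺ˡ (∈-map⁺ (λ y → f y x) x∈xs))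
  ∈-offDiagonalWith⁺ {x ∷ xs} (there x∈xs) (there y∈xs) x≢y =
    ∈-++⁺ʳ (map (f x) xs) (∈-++⁺ʳ (map (λ y → f y x) xs) (∈-offDiagonalWith⁺ x∈xs y∈xs x≢y))

  ∈-offDiagonalWith⁻ : ∀ {xs v} → Unique xs → v ∈ offDiagonalWith f xs →
    ∃₂ λ x y → x ∈ xs × y ∈ xs × x ≢ y × v ≡ f x y
  ∈-offDiagonalWith⁻ {x ∷ xs} (x∉xs ∷ xs!) v∈ with ∈-++⁻ (map (f x) xs) v∈
  ... | inj₁ v∈row with ∈-map⁻ (f x) v∈row
  ...   | y , y∈xs , v≡ = x , y , here refl , there y∈xs , All.lookup x∉xs y∈xs , v≡
  ∈-offDiagonalWith⁻ {x ∷ xs} (x∉xs ∷ xs!) v∈ | inj₂ v∈rest with ∈-++⁻ (map (λ y → f y x) xs) v∈rest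
  ...   | inj₁ v∈col with ∈-map⁻ (λ y → f y x) v∈col
  ...     | y , y∈xs , v≡ = y , x , there y∈xs , here refl , (λ y≡x → All.lookup x∉xs y∈xs (sym y≡x)) , v≡
  ∈-offDiagonalWith⁻ {x ∷ xs} (x∉xs ∷ xs!) v∈ | inj₂ v∈rest | inj₂ v∈off
    with ∈-offDiagonalWith⁻ xs! v∈off
  ...     | y , z , y∈xs , z∈xs , y≢z , v≡ = y , z , there y∈xs , there z∈xs , y≢z , v≡

  offDiagonalWith⁺ : (∀ {w x y z} → f w y ≡ f x z → w ≡ x × y ≡ z) →
    ∀ {xs} → Unique xs → Unique (offDiagonalWith f xs)
  offDiagonalWith⁺ f-inj {[]} [] = []
  offDiagonalWith⁺ f-inj {x ∷ xs} (x∉xs ∷ xs!) =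
    Unique.++⁺ (Unique.map⁺ (proj₂ ∘ f-inj) xs!)
      (Unique.++⁺ (Unique.map⁺ (proj₁ ∘ f-inj) xs!) (offDiagonalWith⁺ f-inj xs!) col#off)
      row#rest
    where
    x≢member : ∀ {z} → z ∈ xs → x ≢ z
    x≢member = All.lookup x∉xs
    col#off : ∀ {v} → ¬ (v ∈ map (λ y → f y x) xs × v ∈ offDiagonalWith f xs)
    col#off (v∈col , v∈off) with ∈-map⁻ (λ y → f y x) v∈col | ∈-offDiagonalWith⁻ xs! v∈off
    ... | _ , _ , refl | _ , _ , _ , z∈xs , _ , fyx≡fwz = x≢member z∈xs (proj₂ (f-inj fyx≡fwz))
    row#rest : ∀ {v} → ¬ (v ∈ map (f x) xs × v ∈ map (λ y → f y x) xs ++ offDiagonalWith f xs)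
    row#rest (v∈row , v∈rest) with ∈-map⁻ (f x) v∈row | ∈-++⁻ (map (λ y → f y x) xs) v∈rest
    ... | _ , _ , refl | inj₁ v∈col with ∈-map⁻ (λ y → f y x) v∈col
    ...   | _ , z∈xs , fxy≡fzx = x≢member z∈xs (proj₁ (f-inj fxy≡fzx))
    row#rest (v∈row , v∈rest) | _ , _ , refl | inj₂ v∈off with ∈-offDiagonalWith⁻ xs! v∈off
    ...   | _ , _ , w∈xs , _ , _ , fxy≡fwz = x≢member w∈xs (proj₁ (f-inj fxy≡fwz))

module _ {I : Set} (f : I → List A) (key : A → I) where

  LiesOver : I → Set
  LiesOver i = ∀ {x} → x ∈ f i → key x ≡ i

  ∈-concatMap-fibred⁻ : ∀ {is x} → All LiesOver is → x ∈ concatMap f is → key x ∈ is × x ∈ f (key x)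
  ∈-concatMap-fibred⁻ over x∈ with find (∈-concatMap⁻ f x∈)
  ... | i , i∈is , x∈fi rewrite All.lookup over i∈is x∈fi = i∈is , x∈fi

  concatMap-fibred⁺ : ∀ {is} → Unique is → All (λ i → Unique (f i) × LiesOver i) is →
    Unique (concatMap f is)
  concatMap-fibred⁺ {[]} [] [] = []
  concatMap-fibred⁺ {i ∷ is} (i∉is ∷ is!) ((fi! , fi-over) ∷ rest) =
    Unique.++⁺ fi! (concatMap-fibred⁺ is! rest) fi#rest
    where
    fi#rest : ∀ {x} → ¬ (x ∈ f i × x ∈ concatMap f is)
    fi#rest (x∈fi , x∈rest) with ∈-concatMap-fibred⁻ (All.map proj₂ rest) x∈rest
    ... | key∈is , _ rewrite fi-over x∈fi = All.lookup i∉is key∈is refl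

record Enumerates (P : A → Set) (xs : List A) : Set where
  field
    unique   : Unique xs
    sound    : ∀ {x} → x ∈ xs → P x
    complete : ∀ {x} → P x → x ∈ xs

sum-map-+ : ∀ (g h : A → ℕ) {k : A → ℕ} {xs} → All (λ x → g x + h x ≡ k x) xs →
  sum (map g xs) + sum (map h xs) ≡ sum (map k xs)
sum-map-+ g h [] = refl
sum-map-+ g h {xs = x ∷ xs} (gx+hx≡kx ∷ rest) =
  trans (interchange (g x) (sum (map g xs)) (h x) (sum (map h xs))) (cong₂ _+_ gx+hx≡kx (sum-map-+ g h rest))

sum-map-zero : ∀ (f : A → ℕ) {xs} → All (λ x → f x ≡ 0) xs → sum (map f xs) ≡ 0
sum-map-zero f [] = refl
sum-map-zero f (fx≡0 ∷ rest) = cong₂ _+_ fx≡0 (sum-map-zero f rest)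

sum-map-delta : ∀ (f : A → ℕ) {xs x} → Unique xs → x ∈ xs → (∀ y → y ≢ x → f y ≡ 0) →
  sum (map f xs) ≡ f x
sum-map-delta f {x = x} (x∉xs ∷ _) (here refl) vanish =
  trans (cong (f x +_) (sum-map-zero f (All.map (λ x≢y → vanish _ (x≢y ∘ sym)) x∉xs))) (+-identityʳ (f x))
sum-map-delta f (y∉xs ∷ xs!) (there x∈xs) vanish =
  cong₂ _+_ (vanish _ (All.lookup y∉xs x∈xs)) (sum-map-delta f xs! x∈xs vanish)

data ParityView : ℕ → Set where
  even : ∀ m → ParityView (m + m)
  odd  : ∀ m → ParityView (suc (m + m))

parityView : ∀ n → ParityView n
parityView zero = even 0
parityView (suc n) with parityView n
... | even m = odd m
... | odd m = subst ParityView (cong suc (+-suc m m)) (even (suc m))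

m+m≡m*2 : ∀ m → m + m ≡ m * 2
m+m≡m*2 m = trans (cong (m +_) (sym (+-identityʳ m))) (*-comm 2 m)

[m+m]/2≡m : ∀ m → (m + m) / 2 ≡ m
[m+m]/2≡m m = trans (cong (_/ 2) (m+m≡m*2 m)) (m*n/n≡m m 2)

[m+m]%2≡0 : ∀ m → (m + m) % 2 ≡ 0
[m+m]%2≡0 m = trans (cong (_% 2) (m+m≡m*2 m)) (m*n%n≡0 m 2)

[1+m+m]%2≡1 : ∀ m → suc (m + m) % 2 ≡ 1
[1+m+m]%2≡1 m = trans (cong (λ k → suc k % 2) (m+m≡m*2 m)) ([m+kn]%n≡m%n 1 m 2)

[2+m+m]%2≡0 : ∀ m → suc (suc (m + m)) % 2 ≡ 0
[2+m+m]%2≡0 m = trans (cong (λ k → suc (suc k) % 2) (m+m≡m*2 m)) ([m+kn]%n≡m%n 2 m 2)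

m+m-injective : ∀ {i m} → i + i ≡ m + m → i ≡ m
m+m-injective {i} {m} eq = *-cancelʳ-≡ i m 2 (trans (sym (m+m≡m*2 i)) (trans eq (m+m≡m*2 m)))

m+m≢1+n+n : ∀ m n → m + m ≢ suc (n + n)
m+m≢1+n+n m n eq = 0≢1+n (trans (sym ([m+m]%2≡0 m)) (trans (cong (_% 2) eq) ([1+m+m]%2≡1 n)))

·-injective : ∀ {x y x′ y′} → x · y ≡ x′ · y′ → x ≡ x′ × y ≡ y′
·-injective refl = refl , refl

data SquareFree : Term → Set where
  var : ∀ i → SquareFree (var i)
  M   : SquareFree M
  app : ∀ {x y} → SquareFree x → SquareFree y → (x ≡ y → x ≡ M) → SquareFree (x · y)

⇒-into-squareFree : ∀ {s t} → s ⇒ t → SquareFree t → s ≡ t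
⇒-into-squareFree (M-step x)  (app _ _ x≡M) = cong (_· x) (sym (x≡M refl))
⇒-into-squareFree (left y s⇒x) (app sx _ _) = cong (_· y) (⇒-into-squareFree s⇒x sx)
⇒-into-squareFree (right x s⇒y) (app _ sy _) = cong (x ·_) (⇒-into-squareFree s⇒y sy)

squareFree⇒minimal : ∀ {t} → SquareFree t → Minimal t
squareFree⇒minimal st s ε = refl
squareFree⇒minimal st s (s⇒u ◅ u≼t) with squareFree⇒minimal st _ u≼t
... | refl = ⇒-into-squareFree s⇒u st

minimal⇒squareFree : ∀ t → Minimal t → SquareFree t
minimal⇒squareFree (var i) _ = var i
minimal⇒squareFree M _ = M
minimal⇒squareFree (x · y) min =
  app (minimal⇒squareFree x minˡ) (minimal⇒squareFree y minʳ) x≡y⇒x≡M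
  where
  minˡ : Minimal x
  minˡ s s≼x = proj₁ (·-injective (min (s · y) (gmap (_· y) (left y) s≼x)))
  minʳ : Minimal y
  minʳ s s≼y = proj₂ (·-injective (min (x · s) (gmap (x ·_) (right x) s≼y)))
  x≡y⇒x≡M : x ≡ y → x ≡ M
  x≡y⇒x≡M refl = sym (proj₁ (·-injective (min (M · x) (M-step x ◅ ε))))

SquareFreeOfDegree : ℕ → Term → Set
SquareFreeOfDegree d t = Combinator t × degree t ≡ d × SquareFree t

leftDegree : Term → ℕ
leftDegree (x · _) = degree x
leftDegree _       = 0

applicationsAt : (ℕ → List Term) → ℕ → ℕ → List Term
applicationsAt g n i with i + i ≟ n
... | yes _ = offDiagonalWith _·_ (g i)
... | no _  = cartesianProductWith _·_ (g i) (g (n ∸ i))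

-- The first argument is fuel: minimals fuel d is correct for d < fuel.
minimals : ℕ → ℕ → List Term
minimals zero _ = []
minimals (suc fuel) zero = [ M ]
minimals (suc fuel) (suc zero) = [ M · M ]
minimals (suc fuel) (suc n@(suc _)) = concatMap (applicationsAt (minimals fuel) n) (upTo (suc n))

·-squareFreeOfDegree : ∀ {i j x y} → SquareFreeOfDegree i x → SquareFreeOfDegree j y →
  (x ≡ y → x ≡ M) → SquareFreeOfDegree (suc (i + j)) (x · y)
·-squareFreeOfDegree (cx , refl , sx) (cy , refl , sy) sq = ·-comb cx cy , refl , app sx sy sq

module Level (g : ℕ → List Term) (k : ℕ)
  (g-enum : ∀ {i} → i ≤ suc k → Enumerates (SquareFreeOfDegree i) (g i)) where

  open Enumerates

  n : ℕ
  n = suc k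

  applicationsAt-unique : ∀ {i} → i ≤ n → Unique (applicationsAt g n i)
  applicationsAt-unique {i} i≤n with i + i ≟ n
  ... | yes _ = offDiagonalWith⁺ _·_ ·-injective (unique (g-enum i≤n))
  ... | no _  = Unique.cartesianProductWith⁺ _·_ ·-injective
                  (unique (g-enum i≤n)) (unique (g-enum (m∸n≤m n i)))

  applicationsAt-sound : ∀ {i t} → i ≤ n → t ∈ applicationsAt g n i →
    SquareFreeOfDegree (suc n) t × leftDegree t ≡ i
  applicationsAt-sound {i} i≤n t∈ with i + i ≟ n
  ... | yes i+i≡n with ∈-offDiagonalWith⁻ _·_ (unique (g-enum i≤n)) t∈
  ...   | x , y , x∈ , y∈ , x≢y , refl =
    subst (λ d → SquareFreeOfDegree (suc d) (x · y)) i+i≡n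
      (·-squareFreeOfDegree (sound (g-enum i≤n) x∈) (sound (g-enum i≤n) y∈) (⊥-elim ∘ x≢y))
    , proj₁ (proj₂ (sound (g-enum i≤n) x∈))
  applicationsAt-sound {i} i≤n t∈ | no i+i≢n with ∈-cartesianProductWith⁻ _·_ (g i) (g (n ∸ i)) t∈
  ...   | x , y , x∈ , y∈ , refl =
    subst (λ d → SquareFreeOfDegree (suc d) (x · y)) (m+[n∸m]≡n i≤n)
      (·-squareFreeOfDegree x-good y-good (⊥-elim ∘ x≢y))
    , proj₁ (proj₂ x-good)
    where
    x-good = sound (g-enum i≤n) x∈
    y-good = sound (g-enum (m∸n≤m n i)) y∈
    x≢y : x ≢ y
    x≢y refl = i+i≢n (subst (λ j → i + j ≡ n) i≡n∸i (m+[n∸m]≡n i≤n))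
      where
      i≡n∸i : n ∸ i ≡ i
      i≡n∸i = trans (sym (proj₁ (proj₂ y-good))) (proj₁ (proj₂ x-good))

  applicationsAt-complete : ∀ {x y} → SquareFreeOfDegree (suc n) (x · y) →
    degree x ≤ n × x · y ∈ applicationsAt g n (degree x)
  applicationsAt-complete {x} {y} (·-comb cx cy , deg , app sx sy sq) =
    degree-x≤n , complete′
    where
    dx+dy≡n : degree x + degree y ≡ n
    dx+dy≡n = suc-injective deg
    degree-x≤n : degree x ≤ n
    degree-x≤n = subst (degree x ≤_) dx+dy≡n (m≤m+n (degree x) (degree y))
    x∈ : x ∈ g (degree x)
    x∈ = complete (g-enum degree-x≤n) (cx , refl , sx)
    complete′ : x · y ∈ applicationsAt g n (degree x)
    complete′ with degree x + degree x ≟ n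
    ... | yes dx+dx≡n = ∈-offDiagonalWith⁺ _·_ x∈ y∈ x≢y
      where
      dy≡dx : degree y ≡ degree x
      dy≡dx = +-cancelˡ-≡ (degree x) (degree y) (degree x) (trans dx+dy≡n (sym dx+dx≡n))
      y∈ : y ∈ g (degree x)
      y∈ = complete (g-enum degree-x≤n) (cy , dy≡dx , sy)
      -- The only square-free square is M M, of degree 1 < suc n.
      x≢y : x ≢ y
      x≢y x≡y with sq x≡y
      ... | refl = 0≢1+n dx+dx≡n
    ... | no _ = ∈-cartesianProductWith⁺ _·_ x∈ y∈
      where
      y∈ : y ∈ g (n ∸ degree x)
      y∈ = complete (g-enum (m∸n≤m n (degree x)))
        (cy , trans (sym (m+n∸m≡n (degree x) (degree y))) (cong (_∸ degree x) dx+dy≡n) , sy)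

  level : Enumerates (SquareFreeOfDegree (suc n)) (concatMap (applicationsAt g n) (upTo (suc n)))
  level = record
    { unique   = concatMap-fibred⁺ (applicationsAt g n) leftDegree (Unique.upTo⁺ (suc n)) fibred
    ; sound    = level-sound
    ; complete = level-complete
    }
    where
    ≤-of : ∀ {i} → i ∈ upTo (suc n) → i ≤ n
    ≤-of i∈ = s≤s⁻¹ (∈-upTo⁻ i∈)
    fibred : All (λ i → Unique (applicationsAt g n i) × LiesOver (applicationsAt g n) leftDegree i)
                 (upTo (suc n))
    fibred = All.tabulate λ i∈ →
      applicationsAt-unique (≤-of i∈) , λ t∈ → proj₂ (applicationsAt-sound (≤-of i∈) t∈)
    level-sound : ∀ {t} → t ∈ concatMap (applicationsAt g n) (upTo (suc n)) → SquareFreeOfDegree (suc n) t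
    level-sound t∈ with ∈-concatMap-fibred⁻ (applicationsAt g n) leftDegree (All.map proj₂ fibred) t∈
    ... | key∈ , t∈′ = proj₁ (applicationsAt-sound (≤-of key∈) t∈′)
    level-complete : ∀ {t} → SquareFreeOfDegree (suc n) t → t ∈ concatMap (applicationsAt g n) (upTo (suc n))
    level-complete {x · y} good with applicationsAt-complete good
    ... | dx≤n , t∈ = ∈-concatMap⁺ (applicationsAt g n) (lose (∈-upTo⁺ (s≤s dx≤n)) t∈)
    level-complete {M} (_ , () , _)

minimals-enumerates : ∀ {fuel d} → d < fuel → Enumerates (SquareFreeOfDegree d) (minimals fuel d)
minimals-enumerates {suc fuel} {zero} _ = record
  { unique   = [] ∷ []
  ; sound    = λ { (here refl) → M-comb , refl , M }
  ; complete = λ { (M-comb , _ , _) → here refl ; (·-comb _ _ , () , _) }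
  }
minimals-enumerates {suc fuel} {suc zero} _ = record
  { unique   = [] ∷ []
  ; sound    = λ { (here refl) → ·-squareFreeOfDegree (M-comb , refl , M) (M-comb , refl , M) (λ _ → refl) }
  ; complete = λ { (·-comb M-comb M-comb , _ , _) → here refl
                 ; (·-comb (·-comb _ _) _ , () , _)
                 ; (·-comb M-comb (·-comb _ _) , () , _) }
  }
minimals-enumerates {suc fuel} {suc (suc k)} (s≤s d<fuel) =
  Level.level (minimals fuel) k (λ i≤n → minimals-enumerates (≤-trans (s≤s i≤n) d<fuel))

module Counting (a : ℕ → ℕ) where

  -- The number of squares x x with degree x ≡ i among the applications of degree suc n.
  diagonal : ℕ → ℕ → ℕ
  diagonal n i with i + i ≟ n
  ... | yes _ = a i
  ... | no _  = 0

  sum-diagonal : ∀ n → sum (map (diagonal n) (upTo (suc n))) ≡ suc n % 2 * a (n / 2)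
  sum-diagonal n with parityView n
  ... | even m = begin
    sum (map (diagonal (m + m)) (upTo (suc (m + m))))
      ≡⟨ sum-map-delta (diagonal (m + m)) (Unique.upTo⁺ _) (∈-upTo⁺ (s≤s (m≤m+n m m))) off-half ⟩
    diagonal (m + m) m  ≡⟨ at-half ⟩
    1 * a m             ≡⟨ cong₂ (λ r h → r * a h) (sym ([1+m+m]%2≡1 m)) (sym ([m+m]/2≡m m)) ⟩
    suc (m + m) % 2 * a ((m + m) / 2) ∎
    where
    open ≡-Reasoning
    off-half : ∀ i → i ≢ m → diagonal (m + m) i ≡ 0
    off-half i i≢m with i + i ≟ m + m
    ... | yes i+i≡m+m = ⊥-elim (i≢m (m+m-injective i+i≡m+m))
    ... | no _ = refl
    at-half : diagonal (m + m) m ≡ 1 * a m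
    at-half with m + m ≟ m + m
    ... | yes _ = sym (+-identityʳ (a m))
    ... | no m+m≢m+m = ⊥-elim (m+m≢m+m refl)
  ... | odd m = trans (sum-map-zero (diagonal (suc (m + m))) {upTo (suc (suc (m + m)))}
                                    (All.tabulate λ {i} _ → never i))
                      (cong (_* a (suc (m + m) / 2)) (sym ([2+m+m]%2≡0 m)))
    where
    never : ∀ i → diagonal (suc (m + m)) i ≡ 0
    never i with i + i ≟ suc (m + m)
    ... | yes i+i≡1+m+m = ⊥-elim (m+m≢1+n+n i m i+i≡1+m+m)
    ... | no _ = refl

  length-applicationsAt : ∀ g n i → length (g i) ≡ a i → length (g (n ∸ i)) ≡ a (n ∸ i) →
    length (applicationsAt g n i) + diagonal n i ≡ a i * a (n ∸ i)
  length-applicationsAt g n i |gi| |gn∸i| with i + i ≟ n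
  ... | yes i+i≡n = begin
    length (offDiagonalWith _·_ (g i)) + a i              ≡⟨ cong (length (offDiagonalWith _·_ (g i)) +_) (sym |gi|) ⟩
    length (offDiagonalWith _·_ (g i)) + length (g i)     ≡⟨ length-offDiagonalWith _·_ (g i) ⟩
    length (g i) * length (g i)                           ≡⟨ cong₂ _*_ |gi| (trans |gi| (cong a (sym n∸i≡i))) ⟩
    a i * a (n ∸ i)                                       ∎
    where
    open ≡-Reasoning
    n∸i≡i : n ∸ i ≡ i
    n∸i≡i = trans (cong (_∸ i) (sym i+i≡n)) (m+n∸m≡n i i)
  ... | no _ = trans (+-identityʳ _)
    (trans (length-cartesianProductWith _·_ (g i) (g (n ∸ i))) (cong₂ _*_ |gi| |gn∸i|))

  length-level : ∀ g n → (∀ {i} → i ≤ n → length (g i) ≡ a i) →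
    length (concatMap (applicationsAt g n) (upTo (suc n))) + suc n % 2 * a (n / 2) ≡ b a n
  length-level g n |g| = begin
    length (concatMap (applicationsAt g n) (upTo (suc n))) + suc n % 2 * a (n / 2)
      ≡⟨ cong₂ _+_ (length-concatMap (applicationsAt g n) (upTo (suc n))) (sym (sum-diagonal n)) ⟩
    sum (map (length ∘ applicationsAt g n) (upTo (suc n))) + sum (map (diagonal n) (upTo (suc n)))
      ≡⟨ sum-map-+ (length ∘ applicationsAt g n) (diagonal n) (All.tabulate pointwise) ⟩
    b a n ∎
    where
    open ≡-Reasoning
    pointwise : ∀ {i} → i ∈ upTo (suc n) → length (applicationsAt g n i) + diagonal n i ≡ a i * a (n ∸ i)
    pointwise {i} i∈ = length-applicationsAt g n i (|g| (s≤s⁻¹ (∈-upTo⁻ i∈))) (|g| (m∸n≤m n i))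

length-minimals : ∀ (a : ℕ → ℕ) → a 0 ≡ 1 → a 1 ≡ 1 →
  (∀ d → d ≥ 2 → a d + (d % 2) * a ((d ∸ 1) / 2) ≡ b a (d ∸ 1)) →
  ∀ {fuel d} → d < fuel → length (minimals fuel d) ≡ a d
length-minimals a a0 a1 rec {suc fuel} {zero} _ = sym a0
length-minimals a a0 a1 rec {suc fuel} {suc zero} _ = sym a1
length-minimals a a0 a1 rec {suc fuel} {d@(suc (suc k))} (s≤s d<fuel) =
  +-cancelʳ-≡ _ _ _ (trans (Counting.length-level a (minimals fuel) (suc k) |minimals|)
                           (sym (rec d (s≤s (s≤s z≤n)))))
  where
  |minimals| : ∀ {i} → i ≤ suc k → length (minimals fuel i) ≡ a i
  |minimals| i≤n = length-minimals a a0 a1 rec (≤-trans (s≤s i≤n) d<fuel)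

mainTheorem11 : (a : ℕ → ℕ) → a 0 ≡ 1 → a 1 ≡ 1 →
    (∀ d → d ≥ 2 → a d + (d % 2) * a ((d ∸ 1) / 2) ≡ b a (d ∸ 1)) →
    ∀ d → Σ (List Term) λ L → Unique L ×
      (∀ t → (t ∈ L) ⇔ (Combinator t × degree t ≡ d × Minimal t)) ×
      length L ≡ a d
mainTheorem11 a a0 a1 rec d =
  minimals (suc d) d ,
  unique ,
  (λ t → mk⇔ (map₂ (map₂ squareFree⇒minimal) ∘ sound) (complete ∘ map₂ (map₂ (minimal⇒squareFree t)))) ,
  length-minimals a a0 a1 rec ≤-refl
  where open Enumerates (minimals-enumerates {suc d} ≤-refl)
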